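{- Let $q>2$ be an odd integer. Then $$\liminf_{x\to\infty}\frac{\#\{n\le x: 2\mid f_{2,q}(n)\}}{x}\ge\frac{1}{2q}-\frac{1}{2q^2},$$ and, for $q\ge5$, $$\#\{n\le x: 2\nmid f_{2,q}(n)\}\gg_q x^{\frac{\log\frac{q-1}{2}}{\log q}}$$ for all sufficiently large $x$ (with implied constant depending only on $q$), where $n$ ranges over positive integers. Moreover, $f_{2,3}(n)$ is odd for infinitely many $n$.
   Context: $\mathbb{N}$ denotes the set of nonnegative integers. For an odd integer $q>2$, $f_{2,q}(n)$ denotes the number of different expressions of the positive integer $n$ as a sum of distinct terms taken from $\{2^{\alpha}q^{\beta}:\alpha,\beta\in\mathbb{N}\}$ (i.e. the number of finite subsets of this set whose elements sum to $n$). -}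

module Defs where

open import Data.Nat using (ℕ; zero; suc; _+_; _*_; _∸_; _^_; _≡ᵇ_; _%_)
open import Data.Bool using (Bool; true; false)
open import Data.List using (List; []; _∷_; _++_; map; filter; length; upTo)
open import Data.Bool.ListAction using (any)
open import Data.Nat.ListAction using (sum)
open import Data.List.Relation.Unary.Any using ()
open import Relation.Binary.PropositionalEquality using (_≡_)
open import Relation.Nullary.Decidable using (Dec)
open import Data.Bool.Properties using (T?)
open import Data.Bool using (T)

range1 : ℕ → List ℕ
range1 n = map suc (upTo n)

-- isTerm q m = true  iff  m = 2^a * q^b for some a b ∈ ℕ.
-- (For m ≥ 1 and q ≥ 2 any such a, b satisfy a , b ≤ m, so the bounded search is exact.)
isTerm : ℕ → ℕ → Bool
isTerm q m = any (λ a → any (λ b → (2 ^ a * q ^ b) ≡ᵇ m) (upTo (suc m))) (upTo (suc m))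

terms : ℕ → ℕ → List ℕ
terms q n = filter (λ m → T? (isTerm q m)) (range1 n)

-- All sublists (= subsets, since the list has distinct entries) of a list.
subsets : {A : Set} → List A → List (List A)
subsets [] = [] ∷ []
subsets (x ∷ xs) = subsets xs ++ map (x ∷_) (subsets xs)

-- f q n = f_{2,q}(n): number of finite subsets of {2^a q^b} with sum n.
-- (Any such subset consists of elements ≤ n.)
f : ℕ → ℕ → ℕ
f q n = length (filter (λ s → T? (sum s ≡ᵇ n)) (subsets (terms q n)))

countEven : ℕ → ℕ → ℕ
countEven q x = length (filter (λ n → T? ((f q n % 2) ≡ᵇ 0)) (range1 x))

countOdd : ℕ → ℕ → ℕ
countOdd q x = length (filter (λ n → T? ((f q n % 2) ≡ᵇ 1)) (range1 x))

{-# OPTIONS --safe #-}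
module Submission where

-- Every term 2^α q^β is either a power of two or q times a term, and not both since q is odd.
-- As every number has exactly one binary expansion, this gives f(n) = Σ_{k ≤ n/q} f(k). Hence f is
-- constant on each block [qk, qk + q), with value g(k) = f(qk), and g(k + 1) = g(k) + g(⌊(k + 1)/q⌋).
-- So if g(m) is odd, the parity of g alternates along the block [qm, qm + q), which therefore holds
-- (q − 1)/2 odd and (q − 1)/2 even values of g.
-- Even values: each m < x/q² either has g(m) even or produces (q − 1)/2 even values of g in its block,
-- and each value of g is taken by f on q consecutive arguments.
-- Odd values: starting from g(2) = 3, each odd value of g in [2qᴸ, 3qᴸ) produces (q − 1)/2 odd values
-- in [2qᴸ⁺¹, 3qᴸ⁺¹), so f takes at least ((q − 1)/2)ᴸ odd values below 3qᴸ⁺¹.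

open import Defs
open import Data.Bool using (Bool; true; false; not; _∧_; _∨_; if_then_else_; T)
open import Data.Bool.ListAction using (any)
open import Data.Bool.Properties using (T?; T-∧; T-∨; ∧-zeroʳ; ∧-identityʳ; ∨-identityʳ)
open import Data.Empty using (⊥-elim)
open import Data.List using (List; []; _∷_; _++_; _∷ʳ_; [_]; map; filter; length; upTo; applyUpTo)
open import Data.List.Properties using (filter-++; length-++; map-++; upTo-∷ʳ; map-upTo; ++-identityʳ)
open import Data.List.Relation.Unary.Any.Properties using (any⁺; any⁻; applyUpTo⁺; applyUpTo⁻)
open import Data.Nat
open import Data.Nat.Coprimality using (Coprime; coprime-divisor; coprime-+; 1-coprimeTo)
open import Data.Nat.Divisibility using (_∣_; divides; divides-refl; ∣1⇒≡1; m%n≡0⇒n∣m; n∣m⇒m%n≡0)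
open import Data.Nat.DivMod
open import Data.Nat.Induction using (<-rec)
open import Data.Nat.ListAction using (sum)
open import Data.Nat.Properties
open import Algebra.Properties.CommutativeSemigroup +-commutativeSemigroup using (interchange)
open import Algebra.Properties.CommutativeSemigroup *-commutativeSemigroup
  using () renaming (interchange to *-interchange; x∙yz≈y∙xz to x*[y*z]≡y*[x*z])
open import Data.Nat.Tactic.RingSolver using (solve-∀)
open import Data.Product using (_×_; _,_; ∃; ∃-syntax)
open import Data.Sum using (inj₁; inj₂)
open import Function using (_∘_; id)
open import Function.Bundles using (Equivalence)
open import Relation.Binary.PropositionalEquality hiding ([_])
open import Relation.Nullary using (¬_; yes; no)

variable
  a k l l′ m n r s x : ℕ
  u v u′ v′ : ℕ → ℕ

Bool-ext : {b c : Bool} → (T b → T c) → (T c → T b) → b ≡ c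
Bool-ext {false} {false} _ _ = refl
Bool-ext {false} {true}  _ g = ⊥-elim (g _)
Bool-ext {true}  {false} f _ = ⊥-elim (f _)
Bool-ext {true}  {true}  _ _ = refl

toℕ : Bool → ℕ
toℕ b = if b then 1 else 0

n<b^n : ∀ b → 1 < b → ∀ n → n < b ^ n
n<b^n b         1<b zero    = s≤s z≤n
n<b^n b@(suc _) 1<b (suc n) = begin-strict
  suc n     ≤⟨ n<b^n b 1<b n ⟩
  b ^ n     <⟨ m<m*n (b ^ n) b {{m^n≢0 b n}} 1<b ⟩
  b ^ n * b ≡⟨ *-comm (b ^ n) b ⟩
  b ^ suc n ∎
  where open ≤-Reasoning

n≤1+2[n/2] : ∀ n → n ≤ suc (2 * (n / 2))
n≤1+2[n/2] n = begin
  n                   ≡⟨ m≡m%n+[m/n]*n n 2 ⟩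
  n % 2 + n / 2 * 2   ≤⟨ +-monoˡ-≤ (n / 2 * 2) (≤-pred (m%n<n n 2)) ⟩
  1 + n / 2 * 2       ≡⟨ cong suc (*-comm (n / 2) 2) ⟩
  suc (2 * (n / 2))   ∎
  where open ≤-Reasoning

⌊1+2h/2⌋≡h : ∀ h → ⌊ 1 + 2 * h /2⌋ ≡ h
⌊1+2h/2⌋≡h zero    = refl
⌊1+2h/2⌋≡h (suc h) = trans (cong (λ n → ⌊ suc n /2⌋) (*-suc 2 h)) (cong suc (⌊1+2h/2⌋≡h h))

coprime-odd-2 : ∀ h → Coprime (1 + 2 * h) 2
coprime-odd-2 zero    = 1-coprimeTo 2
coprime-odd-2 (suc h) = subst (λ m → Coprime m 2) (cong suc (sym (*-suc 2 h))) (coprime-+ (coprime-odd-2 h))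

[m*n]^o≡m^o*n^o : ∀ m n o → (m * n) ^ o ≡ m ^ o * n ^ o
[m*n]^o≡m^o*n^o m n zero    = refl
[m*n]^o≡m^o*n^o m n (suc o) = trans (cong (m * n *_) ([m*n]^o≡m^o*n^o m n o)) (*-interchange m n (m ^ o) (n ^ o))

[m^n]^o≡[m^o]^n : ∀ m n o → (m ^ n) ^ o ≡ (m ^ o) ^ n
[m^n]^o≡[m^o]^n m n o = trans (^-*-assoc m n o) (trans (cong (m ^_) (*-comm n o)) (sym (^-*-assoc m o n)))

power-transfer : ∀ b h K c L j k → .{{_ : NonZero b}} → .{{_ : NonZero K}} → h ≤ b →
  x ≤ K * b ^ L → h ^ L ≤ c → b ^ j < h ^ k → x ^ j ≤ (K * c) ^ k
power-transfer {x} b h K c L j k h≤b x≤Kb^L h^L≤c b^j<h^k = begin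
  x ^ j               ≤⟨ ^-monoˡ-≤ j x≤Kb^L ⟩
  (K * b ^ L) ^ j     ≡⟨ [m*n]^o≡m^o*n^o K (b ^ L) j ⟩
  K ^ j * (b ^ L) ^ j ≡⟨ cong (K ^ j *_) ([m^n]^o≡[m^o]^n b L j) ⟩
  K ^ j * (b ^ j) ^ L ≤⟨ *-mono-≤ (^-monoʳ-≤ K j≤k) (^-monoˡ-≤ L (<⇒≤ b^j<h^k)) ⟩
  K ^ k * (h ^ k) ^ L ≡⟨ cong (K ^ k *_) ([m^n]^o≡[m^o]^n h k L) ⟩
  K ^ k * (h ^ L) ^ k ≡⟨ [m*n]^o≡m^o*n^o K (h ^ L) k ⟨
  (K * h ^ L) ^ k     ≤⟨ ^-monoˡ-≤ k (*-monoʳ-≤ K h^L≤c) ⟩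
  (K * c) ^ k         ∎
  where
  open ≤-Reasoning
  j≤k : j ≤ k
  j≤k with j ≤? k
  ... | yes j≤k = j≤k
  ... | no  j≰k = ⊥-elim (<⇒≱ b^j<h^k (≤-trans (^-monoˡ-≤ k h≤b) (^-monoʳ-≤ b (<⇒≤ (≰⇒> j≰k)))))

bracket : ∀ (u : ℕ → ℕ) → (∀ L → u L < u (suc L)) → u 0 ≤ x → ∃[ L ] (u L ≤ x × x < u (suc L))
bracket u u-increasing u₀≤x with t , refl ← m≤n⇒∃[o]m+o≡n u₀≤x = above-u₀ t
  where
  above-u₀ : ∀ t → ∃[ L ] (u L ≤ u 0 + t × u 0 + t < u (suc L))
  above-u₀ zero    = 0 , m≤m+n (u 0) 0 , ≤-trans (≤-reflexive (cong suc (+-identityʳ (u 0)))) (u-increasing 0)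
  above-u₀ (suc t) with L , uL≤u₀+t , u₀+t<u[1+L] ← above-u₀ t with u 0 + suc t <? u (suc L)
  ... | yes u₀+1+t<u[1+L] = L , ≤-trans uL≤u₀+t (≤-trans (n≤1+n _) (≤-reflexive (sym (+-suc (u 0) t)))) , u₀+1+t<u[1+L]
  ... | no  u₀+1+t≮u[1+L] = suc L , ≮⇒≥ u₀+1+t≮u[1+L] ,
    ≤-trans (s≤s (≤-trans (≤-reflexive (+-suc (u 0) t)) u₀+t<u[1+L])) (u-increasing (suc L))

-- Sequences ℕ → ℕ are read as the coefficient sequences of power series Σ u s · tˢ.

δ₀ : ℕ → ℕ
δ₀ zero    = 1
δ₀ (suc _) = 0

infixl 6 _⊕_
_⊕_ : (ℕ → ℕ) → (ℕ → ℕ) → ℕ → ℕ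
(u ⊕ v) s = u s + v s

shift : ℕ → (ℕ → ℕ) → ℕ → ℕ
shift zero    u s       = u s
shift (suc x) u zero    = 0
shift (suc x) u (suc s) = shift x u s

shift-cong : ∀ x → u ≗ v → shift x u ≗ shift x v
shift-cong zero    e s       = e s
shift-cong (suc x) e zero    = refl
shift-cong (suc x) e (suc s) = shift-cong x e s

shift-⊕ : ∀ x u v → shift x (u ⊕ v) ≗ shift x u ⊕ shift x v
shift-⊕ zero    u v s       = refl
shift-⊕ (suc x) u v zero    = refl
shift-⊕ (suc x) u v (suc s) = shift-⊕ x u v s

shift-shift : ∀ x y u → shift x (shift y u) ≗ shift (x + y) u
shift-shift zero    y u s       = refl
shift-shift (suc x) y u zero    = refl
shift-shift (suc x) y u (suc s) = shift-shift x y u s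

shift-comm : ∀ x y u → shift x (shift y u) ≗ shift y (shift x u)
shift-comm x y u s = begin
  shift x (shift y u) s ≡⟨ shift-shift x y u s ⟩
  shift (x + y) u s     ≡⟨ cong (λ z → shift z u s) (+-comm x y) ⟩
  shift (y + x) u s     ≡⟨ shift-shift y x u s ⟨
  shift y (shift x u) s ∎
  where open ≡-Reasoning

shift-< : ∀ x u → s < x → shift x u s ≡ 0
shift-< {zero}  (suc x) u _         = refl
shift-< {suc s} (suc x) u (s≤s s<x) = shift-< x u s<x

shift-+ : ∀ x u t → shift x u (x + t) ≡ u t
shift-+ zero    u t = refl
shift-+ (suc x) u t = shift-+ x u t

addPart : ℕ → (ℕ → ℕ) → ℕ → ℕ
addPart x u = u ⊕ shift x u

addPart-cong : ∀ x → u ≗ v → addPart x u ≗ addPart x v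
addPart-cong x e s = cong₂ _+_ (e s) (shift-cong x e s)

addPart-comm : ∀ x y u → addPart x (addPart y u) ≗ addPart y (addPart x u)
addPart-comm x y u s = begin
  (u s + shift y u s) + shift x (u ⊕ shift y u) s
    ≡⟨ cong ((u s + shift y u s) +_) (shift-⊕ x u (shift y u) s) ⟩
  (u s + shift y u s) + (shift x u s + shift x (shift y u) s)
    ≡⟨ cong (λ z → (u s + shift y u s) + (shift x u s + z)) (shift-comm x y u s) ⟩
  (u s + shift y u s) + (shift x u s + shift y (shift x u) s)
    ≡⟨ interchange (u s) _ _ _ ⟩
  (u s + shift x u s) + (shift y u s + shift y (shift x u) s)
    ≡⟨ cong ((u s + shift x u s) +_) (shift-⊕ y u (shift x u) s) ⟨
  (u s + shift x u s) + shift y (u ⊕ shift x u) s ∎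
  where open ≡-Reasoning

conv : (ℕ → ℕ) → (ℕ → ℕ) → ℕ → ℕ
conv u v zero    = u 0 * v 0
conv u v (suc s) = u 0 * v (suc s) + conv (u ∘ suc) v s

conv-cong : u ≗ u′ → v ≗ v′ → conv u v ≗ conv u′ v′
conv-cong eu ev zero    = cong₂ _*_ (eu 0) (ev 0)
conv-cong eu ev (suc s) = cong₂ _+_ (cong₂ _*_ (eu 0) (ev (suc s))) (conv-cong (eu ∘ suc) ev s)

conv-⊕ˡ : ∀ u u′ v → conv (u ⊕ u′) v ≗ conv u v ⊕ conv u′ v
conv-⊕ˡ u u′ v zero    = *-distribʳ-+ (v 0) (u 0) (u′ 0)
conv-⊕ˡ u u′ v (suc s) = trans
  (cong₂ _+_ (*-distribʳ-+ (v (suc s)) (u 0) (u′ 0)) (conv-⊕ˡ (u ∘ suc) (u′ ∘ suc) v s))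
  (interchange (u 0 * v (suc s)) _ (conv (u ∘ suc) v s) _)

conv-⊕ʳ : ∀ u v v′ → conv u (v ⊕ v′) ≗ conv u v ⊕ conv u v′
conv-⊕ʳ u v v′ zero    = *-distribˡ-+ (u 0) (v 0) (v′ 0)
conv-⊕ʳ u v v′ (suc s) = trans
  (cong₂ _+_ (*-distribˡ-+ (u 0) (v (suc s)) (v′ (suc s))) (conv-⊕ʳ (u ∘ suc) v v′ s))
  (interchange (u 0 * v (suc s)) _ (conv (u ∘ suc) v s) _)

conv-shiftˡ : ∀ x u v → conv (shift x u) v ≗ shift x (conv u v)
conv-shiftˡ zero    u v s       = refl
conv-shiftˡ (suc x) u v zero    = refl
conv-shiftˡ (suc x) u v (suc s) = conv-shiftˡ x u v s

shift-conv : ∀ x u v s → shift x (conv u v) s ≡ u 0 * shift x v s + shift (suc x) (conv (u ∘ suc) v) s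
shift-conv zero    u v zero    = sym (+-identityʳ _)
shift-conv zero    u v (suc s) = refl
shift-conv (suc x) u v zero    = sym (trans (+-identityʳ _) (*-zeroʳ (u 0)))
shift-conv (suc x) u v (suc s) = shift-conv x u v s

conv-shiftʳ : ∀ x u v → conv u (shift x v) ≗ shift x (conv u v)
conv-shiftʳ zero    u v s       = refl
conv-shiftʳ (suc x) u v zero    = *-zeroʳ (u 0)
conv-shiftʳ (suc x) u v (suc s) = trans
  (cong (u 0 * shift x v s +_) (conv-shiftʳ (suc x) (u ∘ suc) v s))
  (sym (shift-conv x u v s))

conv-addPartˡ : ∀ x u v → conv (addPart x u) v ≗ addPart x (conv u v)
conv-addPartˡ x u v s = trans (conv-⊕ˡ u (shift x u) v s) (cong (conv u v s +_) (conv-shiftˡ x u v s))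

conv-addPartʳ : ∀ x u v → conv u (addPart x v) ≗ addPart x (conv u v)
conv-addPartʳ x u v s = trans (conv-⊕ʳ u v (shift x v) s) (cong (conv u v s +_) (conv-shiftʳ x u v s))

conv-δ₀ˡ : ∀ v → conv δ₀ v ≗ v
conv-δ₀ˡ v zero    = +-identityʳ (v 0)
conv-δ₀ˡ v (suc s) = trans (cong₂ _+_ (+-identityʳ (v (suc s))) (conv-zeroˡ s)) (+-identityʳ (v (suc s)))
  where
  conv-zeroˡ : ∀ s → conv (λ _ → 0) v s ≡ 0
  conv-zeroˡ zero    = refl
  conv-zeroˡ (suc s) = conv-zeroˡ s

sumTo : (ℕ → ℕ) → ℕ → ℕ
sumTo u zero    = 0
sumTo u (suc n) = sumTo u n + u n

sumTo-cong : ∀ n → (∀ i → i < n → u i ≡ v i) → sumTo u n ≡ sumTo v n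
sumTo-cong zero    e = refl
sumTo-cong (suc n) e = cong₂ _+_ (sumTo-cong n (λ i i<n → e i (m<n⇒m<1+n i<n))) (e n ≤-refl)

sumTo-+ : ∀ u m n → sumTo u (m + n) ≡ sumTo u m + sumTo (u ∘ (m +_)) n
sumTo-+ u m zero    = trans (cong (sumTo u) (+-identityʳ m)) (sym (+-identityʳ _))
sumTo-+ u m (suc n) = begin
  sumTo u (m + suc n)                           ≡⟨ cong (sumTo u) (+-suc m n) ⟩
  sumTo u (m + n) + u (m + n)                   ≡⟨ cong (_+ u (m + n)) (sumTo-+ u m n) ⟩
  sumTo u m + sumTo (u ∘ (m +_)) n + u (m + n)  ≡⟨ +-assoc (sumTo u m) _ _ ⟩
  sumTo u m + sumTo (u ∘ (m +_)) (suc n)        ∎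
  where open ≡-Reasoning

conv-oneˡ : (∀ i → i ≤ s → u i ≡ 1) → conv u v s ≡ sumTo v (suc s)
conv-oneˡ {zero}  {u} {v} u≡1 = trans (cong (_* v 0) (u≡1 0 z≤n)) (+-identityʳ (v 0))
conv-oneˡ {suc s} {u} {v} u≡1 = begin
  u 0 * v (suc s) + conv (u ∘ suc) v s ≡⟨ cong₂ _+_ (trans (cong (_* v (suc s)) (u≡1 0 z≤n)) (+-identityʳ _))
                                                    (conv-oneˡ (λ i i≤s → u≡1 (suc i) (s≤s i≤s))) ⟩
  v (suc s) + sumTo v (suc s)          ≡⟨ +-comm (v (suc s)) _ ⟩
  sumTo v (suc (suc s))                ∎
  where open ≡-Reasoning

module _ (d : ℕ) .{{_ : NonZero d}} where

  euclid : ∀ s → ∃[ k ] ∃[ r ] (r < d × s ≡ d * k + r)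
  euclid s = s / d , s % d , m%n<n s d , (begin
    s                  ≡⟨ m≡m%n+[m/n]*n s d ⟩
    s % d + s / d * d  ≡⟨ +-comm (s % d) _ ⟩
    s / d * d + s % d  ≡⟨ cong (_+ s % d) (*-comm (s / d) d) ⟩
    d * (s / d) + s % d ∎)
    where open ≡-Reasoning

  d*k+r≡r+k*d : ∀ k r → d * k + r ≡ r + k * d
  d*k+r≡r+k*d k r = trans (+-comm (d * k) r) (cong (r +_) (*-comm d k))

  [d*k+r]%d≡r : ∀ k → r < d → (d * k + r) % d ≡ r
  [d*k+r]%d≡r {r} k r<d = begin
    (d * k + r) % d ≡⟨ cong (_% d) (d*k+r≡r+k*d k r) ⟩
    (r + k * d) % d ≡⟨ [m+kn]%n≡m%n r k d ⟩
    r % d           ≡⟨ m<n⇒m%n≡m r<d ⟩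
    r               ∎
    where open ≡-Reasoning

  [d*k+r]/d≡k : ∀ k → r < d → (d * k + r) / d ≡ k
  [d*k+r]/d≡k {r} k r<d = begin
    (d * k + r) / d       ≡⟨ cong (_/ d) (d*k+r≡r+k*d k r) ⟩
    (r + k * d) / d       ≡⟨ +-distrib-/-∣ʳ r (divides-refl k) ⟩
    r / d + k * d / d     ≡⟨ cong₂ _+_ (m<n⇒m/n≡0 r<d) (m*n/n≡m k d) ⟩
    k                     ∎
    where open ≡-Reasoning

  d*[1+k]≡1+[d*k+pred[d]] : ∀ k → d * suc k ≡ suc (d * k + pred d)
  d*[1+k]≡1+[d*k+pred[d]] k = begin
    d * suc k            ≡⟨ *-suc d k ⟩
    d + d * k            ≡⟨ cong (_+ d * k) (suc-pred d) ⟨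
    suc (pred d + d * k) ≡⟨ cong suc (+-comm (pred d) (d * k)) ⟩
    suc (d * k + pred d) ∎
    where open ≡-Reasoning

  dilate : (ℕ → ℕ) → ℕ → ℕ
  dilate u s = if s % d ≡ᵇ 0 then u (s / d) else 0

  dilate-*+ : ∀ u k → r < d → dilate u (d * k + r) ≡ (if r ≡ᵇ 0 then u k else 0)
  dilate-*+ u k r<d rewrite [d*k+r]%d≡r k r<d | [d*k+r]/d≡k k r<d = refl

  dilate-* : ∀ u k → dilate u (d * k) ≡ u k
  dilate-* u k = trans (cong (dilate u) (sym (+-identityʳ (d * k)))) (dilate-*+ u k (>-nonZero⁻¹ d))

  dilate-cong : u ≗ v → dilate u ≗ dilate v
  dilate-cong e s with s % d ≡ᵇ 0
  ... | true  = e (s / d)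
  ... | false = refl

  dilate-⊕ : ∀ u v → dilate (u ⊕ v) ≗ dilate u ⊕ dilate v
  dilate-⊕ u v s with s % d ≡ᵇ 0
  ... | true  = refl
  ... | false = refl

  dilate-δ₀ : dilate δ₀ ≗ δ₀
  dilate-δ₀ s with euclid s
  ... | k , suc r , r<d , refl = trans (dilate-*+ δ₀ k r<d) (cong δ₀ (sym (+-suc (d * k) r)))
  ... | zero , zero , 0<d , refl =
    trans (dilate-*+ δ₀ 0 0<d) (cong δ₀ (sym (trans (+-identityʳ (d * 0)) (*-zeroʳ d))))
  ... | suc k , zero , 0<d , refl =
    trans (dilate-*+ δ₀ (suc k) 0<d) (cong δ₀ (sym (trans (+-identityʳ (d * suc k)) (d*[1+k]≡1+[d*k+pred[d]] k))))

  shift-dilate : ∀ x u → shift (d * x) (dilate u) ≗ dilate (shift x u)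
  shift-dilate x u s with euclid s
  ... | k , r , r<d , refl with <-≤-connex k x
  ...   | inj₁ k<x = trans (shift-< (d * x) (dilate u) d*k+r<d*x) (sym (below r r<d))
    where
    d*k+r<d*x : d * k + r < d * x
    d*k+r<d*x = begin-strict
      d * k + r ≡⟨ +-comm (d * k) r ⟩
      r + d * k <⟨ +-monoˡ-< (d * k) r<d ⟩
      d + d * k ≡⟨ *-suc d k ⟨
      d * suc k ≤⟨ *-monoʳ-≤ d k<x ⟩
      d * x     ∎
      where open ≤-Reasoning
    below : ∀ r → r < d → dilate (shift x u) (d * k + r) ≡ 0
    below zero    0<d   = trans (dilate-*+ (shift x u) k 0<d) (shift-< x u k<x)
    below (suc r) 1+r<d = dilate-*+ (shift x u) k 1+r<d
  ...   | inj₂ x≤k with t , refl ← m≤n⇒∃[o]m+o≡n x≤k = begin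
    shift (d * x) (dilate u) (d * (x + t) + r)   ≡⟨ cong (shift (d * x) (dilate u)) d*[x+t]+r≡d*x+[d*t+r] ⟩
    shift (d * x) (dilate u) (d * x + (d * t + r)) ≡⟨ shift-+ (d * x) (dilate u) (d * t + r) ⟩
    dilate u (d * t + r)                         ≡⟨ dilate-*+ u t r<d ⟩
    (if r ≡ᵇ 0 then u t else 0)                  ≡⟨ cong (if r ≡ᵇ 0 then_else 0) (shift-+ x u t) ⟨
    (if r ≡ᵇ 0 then shift x u (x + t) else 0)    ≡⟨ dilate-*+ (shift x u) (x + t) r<d ⟨
    dilate (shift x u) (d * (x + t) + r)         ∎
    where
    open ≡-Reasoning
    d*[x+t]+r≡d*x+[d*t+r] : d * (x + t) + r ≡ d * x + (d * t + r)
    d*[x+t]+r≡d*x+[d*t+r] = trans (cong (_+ r) (*-distribˡ-+ d x t)) (+-assoc (d * x) (d * t) r)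

  addPart-dilate : ∀ x u → addPart (d * x) (dilate u) ≗ dilate (addPart x u)
  addPart-dilate x u s = trans (cong (dilate u s +_) (shift-dilate x u s)) (sym (dilate-⊕ u (shift x u) s))

  sumTo-dilate-block : ∀ u k → r < d → sumTo (dilate u ∘ (d * k +_)) (suc r) ≡ u k
  sumTo-dilate-block {zero}  u k r<d = dilate-*+ u k r<d
  sumTo-dilate-block {suc r} u k r<d = begin
    sumTo (dilate u ∘ (d * k +_)) (suc r) + dilate u (d * k + suc r) ≡⟨ cong₂ _+_ (sumTo-dilate-block u k (<⇒≤ r<d)) (dilate-*+ u k r<d) ⟩
    u k + 0                                                          ≡⟨ +-identityʳ (u k) ⟩
    u k                                                              ∎
    where open ≡-Reasoning

  sumTo-dilate-* : ∀ u k → sumTo (dilate u) (d * k) ≡ sumTo u k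
  sumTo-dilate-* u zero    = cong (sumTo (dilate u)) (*-zeroʳ d)
  sumTo-dilate-* u (suc k) = begin
    sumTo (dilate u) (d * suc k)                                             ≡⟨ cong (sumTo (dilate u)) d*[1+k]≡d*k+d ⟩
    sumTo (dilate u) (d * k + suc (pred d))                                  ≡⟨ sumTo-+ (dilate u) (d * k) (suc (pred d)) ⟩
    sumTo (dilate u) (d * k) + sumTo (dilate u ∘ (d * k +_)) (suc (pred d))  ≡⟨ cong₂ _+_ (sumTo-dilate-* u k) (sumTo-dilate-block u k pred[d]<d) ⟩
    sumTo u (suc k)                                                          ∎
    where
    open ≡-Reasoning
    d*[1+k]≡d*k+d : d * suc k ≡ d * k + suc (pred d)
    d*[1+k]≡d*k+d = trans (d*[1+k]≡1+[d*k+pred[d]] k) (sym (+-suc (d * k) (pred d)))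
    pred[d]<d : pred d < d
    pred[d]<d = ≤-reflexive (suc-pred d)

  sumTo-dilate : ∀ u n → sumTo (dilate u) (suc n) ≡ sumTo u (suc (n / d))
  sumTo-dilate u n with euclid n
  ... | k , r , r<d , refl = begin
    sumTo (dilate u) (suc (d * k + r))                                      ≡⟨ cong (sumTo (dilate u)) (+-suc (d * k) r) ⟨
    sumTo (dilate u) (d * k + suc r)                                        ≡⟨ sumTo-+ (dilate u) (d * k) (suc r) ⟩
    sumTo (dilate u) (d * k) + sumTo (dilate u ∘ (d * k +_)) (suc r)        ≡⟨ cong₂ _+_ (sumTo-dilate-* u k) (sumTo-dilate-block u k r<d) ⟩
    sumTo u (suc k)                                                         ≡⟨ cong (sumTo u ∘ suc) ([d*k+r]/d≡k k r<d) ⟨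
    sumTo u (suc ((d * k + r) / d))                                         ∎
    where open ≡-Reasoning

-- The coefficient of tˢ in ∏ (1 + tˣ) over the x ∈ [1, m] with P x: the number of ways of
-- writing s as a sum of distinct such x.
distinctParts : (ℕ → Bool) → ℕ → ℕ → ℕ
distinctParts P zero    = δ₀
distinctParts P (suc m) = if P (suc m) then addPart (suc m) (distinctParts P m) else distinctParts P m

distinctParts-accept : ∀ P m → P (suc m) ≡ true → distinctParts P (suc m) ≡ addPart (suc m) (distinctParts P m)
distinctParts-accept P m e = cong (λ b → if b then addPart (suc m) (distinctParts P m) else distinctParts P m) e

distinctParts-reject : ∀ P m → P (suc m) ≡ false → distinctParts P (suc m) ≡ distinctParts P m
distinctParts-reject P m e = cong (λ b → if b then addPart (suc m) (distinctParts P m) else distinctParts P m) e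

distinctParts-suc : ∀ P → s ≤ m → distinctParts P (suc m) s ≡ distinctParts P m s
distinctParts-suc {s} {m} P s≤m with P (suc m)
... | true  = trans (cong (distinctParts P m s +_) (shift-< (suc m) _ (s≤s s≤m))) (+-identityʳ _)
... | false = refl

distinctParts-stable : ∀ P → s ≤ m → distinctParts P m s ≡ distinctParts P s s
distinctParts-stable {s} P s≤m with k , refl ← m≤n⇒∃[o]m+o≡n s≤m = stable k
  where
  stable : ∀ k → distinctParts P (s + k) s ≡ distinctParts P s s
  stable zero    = cong (λ m → distinctParts P m s) (+-identityʳ s)
  stable (suc k) = begin
    distinctParts P (s + suc k) s   ≡⟨ cong (λ m → distinctParts P m s) (+-suc s k) ⟩
    distinctParts P (suc (s + k)) s ≡⟨ distinctParts-suc P (m≤m+n s k) ⟩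
    distinctParts P (s + k) s       ≡⟨ stable k ⟩
    distinctParts P s s             ∎
    where open ≡-Reasoning

distinctParts-split : ∀ P P₁ P₂ →
  (∀ x → P (suc x) ≡ P₁ (suc x) ∨ P₂ (suc x)) → (∀ x → P₁ (suc x) ∧ P₂ (suc x) ≡ false) →
  ∀ m → distinctParts P m ≗ conv (distinctParts P₁ m) (distinctParts P₂ m)
distinctParts-split P P₁ P₂ P≡P₁∨P₂ disjoint zero    s = sym (conv-δ₀ˡ δ₀ s)
distinctParts-split P P₁ P₂ P≡P₁∨P₂ disjoint (suc m) s
  rewrite P≡P₁∨P₂ m with P₁ (suc m) | P₂ (suc m) | disjoint m
... | true  | true  | ()
... | true  | false | _ = trans (addPart-cong (suc m) IH s) (sym (conv-addPartˡ (suc m) _ _ s))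
  where IH = distinctParts-split P P₁ P₂ P≡P₁∨P₂ disjoint m
... | false | true  | _ = trans (addPart-cong (suc m) IH s) (sym (conv-addPartʳ (suc m) _ _ s))
  where IH = distinctParts-split P P₁ P₂ P≡P₁∨P₂ disjoint m
... | false | false | _ = distinctParts-split P P₁ P₂ P≡P₁∨P₂ disjoint m s

module _ (d : ℕ) .{{_ : NonZero d}} where

  dilated : (ℕ → Bool) → ℕ → Bool
  dilated P x = (x % d ≡ᵇ 0) ∧ P (x / d)

  dilated-*+ : ∀ P k → r < d → dilated P (d * k + r) ≡ (r ≡ᵇ 0) ∧ P k
  dilated-*+ P k r<d rewrite [d*k+r]%d≡r d k r<d | [d*k+r]/d≡k d k r<d = refl

  dilated-* : ∀ P k → dilated P (d * k) ≡ P k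
  dilated-* P k = trans (cong (dilated P) (sym (+-identityʳ (d * k)))) (dilated-*+ P k (>-nonZero⁻¹ d))

  distinctParts-dilated-block : ∀ P k → r < d → distinctParts (dilated P) (d * k + r) ≗ distinctParts (dilated P) (d * k)
  distinctParts-dilated-block {zero}  P k _     s = cong (λ m → distinctParts (dilated P) m s) (+-identityʳ (d * k))
  distinctParts-dilated-block {suc r} P k 1+r<d s = begin
    distinctParts (dilated P) (d * k + suc r) s   ≡⟨ cong (λ m → distinctParts (dilated P) m s) (+-suc (d * k) r) ⟩
    distinctParts (dilated P) (suc (d * k + r)) s ≡⟨ cong-app (distinctParts-reject (dilated P) (d * k + r) off-multiple) s ⟩
    distinctParts (dilated P) (d * k + r) s       ≡⟨ distinctParts-dilated-block P k (<⇒≤ 1+r<d) s ⟩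
    distinctParts (dilated P) (d * k) s           ∎
    where
    open ≡-Reasoning
    off-multiple : dilated P (suc (d * k + r)) ≡ false
    off-multiple = trans (cong (dilated P) (sym (+-suc (d * k) r))) (dilated-*+ P k 1+r<d)

  distinctParts-dilated-* : ∀ P k → distinctParts (dilated P) (d * k) ≗ dilate d (distinctParts P k)
  distinctParts-dilated-* P zero    s = trans (cong (λ m → distinctParts (dilated P) m s) (*-zeroʳ d)) (sym (dilate-δ₀ d s))
  distinctParts-dilated-* P (suc k) s = begin
    distinctParts (dilated P) (d * suc k) s ≡⟨ cong (λ m → distinctParts (dilated P) m s) d*[1+k]≡1+m′ ⟩
    distinctParts (dilated P) (suc m′) s    ≡⟨ step (P (suc k)) refl ⟩
    dilate d (distinctParts P (suc k)) s    ∎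
    where
    open ≡-Reasoning
    m′ = d * k + pred d
    d*[1+k]≡1+m′ = d*[1+k]≡1+[d*k+pred[d]] d k
    at-multiple : dilated P (suc m′) ≡ P (suc k)
    at-multiple = trans (cong (dilated P) (sym (trans (+-identityʳ _) d*[1+k]≡1+m′))) (dilated-*+ P (suc k) (>-nonZero⁻¹ d))
    previous : distinctParts (dilated P) m′ ≗ dilate d (distinctParts P k)
    previous t = trans (distinctParts-dilated-block P k (≤-reflexive (suc-pred d)) t) (distinctParts-dilated-* P k t)
    step : ∀ b → P (suc k) ≡ b → distinctParts (dilated P) (suc m′) s ≡ dilate d (distinctParts P (suc k)) s
    step true e = begin
      distinctParts (dilated P) (suc m′) s                 ≡⟨ cong-app (distinctParts-accept (dilated P) m′ (trans at-multiple e)) s ⟩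
      addPart (suc m′) (distinctParts (dilated P) m′) s    ≡⟨ addPart-cong (suc m′) previous s ⟩
      addPart (suc m′) (dilate d (distinctParts P k)) s    ≡⟨ cong (λ z → addPart z (dilate d (distinctParts P k)) s) d*[1+k]≡1+m′ ⟨
      addPart (d * suc k) (dilate d (distinctParts P k)) s ≡⟨ addPart-dilate d (suc k) (distinctParts P k) s ⟩
      dilate d (addPart (suc k) (distinctParts P k)) s     ≡⟨ dilate-cong d (cong-app (distinctParts-accept P k e)) s ⟨
      dilate d (distinctParts P (suc k)) s                 ∎
    step false e = begin
      distinctParts (dilated P) (suc m′) s ≡⟨ cong-app (distinctParts-reject (dilated P) m′ (trans at-multiple e)) s ⟩
      distinctParts (dilated P) m′ s       ≡⟨ previous s ⟩
      dilate d (distinctParts P k) s       ≡⟨ dilate-cong d (cong-app (distinctParts-reject P k e)) s ⟨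
      dilate d (distinctParts P (suc k)) s ∎

  distinctParts-dilated : ∀ P m → distinctParts (dilated P) m ≗ dilate d (distinctParts P (m / d))
  distinctParts-dilated P m s with euclid d m
  ... | k , r , r<d , refl = begin
    distinctParts (dilated P) (d * k + r) s           ≡⟨ distinctParts-dilated-block P k r<d s ⟩
    distinctParts (dilated P) (d * k) s               ≡⟨ distinctParts-dilated-* P k s ⟩
    dilate d (distinctParts P k) s                    ≡⟨ dilate-cong d (λ t → cong (λ z → distinctParts P z t) ([d*k+r]/d≡k d k r<d)) s ⟨
    dilate d (distinctParts P ((d * k + r) / d)) s    ∎
    where open ≡-Reasoning

dilate-2-odd : ∀ u j → dilate 2 u (suc (2 * j)) ≡ 0
dilate-2-odd u j = trans (cong (dilate 2 u) (+-comm 1 (2 * j))) (dilate-*+ 2 u j (s≤s (s≤s z≤n)))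

addPart-1-dilate-2-even : ∀ u j → addPart 1 (dilate 2 u) (2 * j) ≡ u j
addPart-1-dilate-2-even u zero    = +-identityʳ (u 0)
addPart-1-dilate-2-even u (suc j) = begin
  dilate 2 u (2 * suc j) + shift 1 (dilate 2 u) (2 * suc j) ≡⟨ cong₂ _+_ (dilate-* 2 u (suc j)) (cong (shift 1 (dilate 2 u)) (*-suc 2 j)) ⟩
  u (suc j) + dilate 2 u (suc (2 * j))                      ≡⟨ cong (u (suc j) +_) (dilate-2-odd u j) ⟩
  u (suc j) + 0                                             ≡⟨ +-identityʳ _ ⟩
  u (suc j)                                                 ∎
  where open ≡-Reasoning

addPart-1-dilate-2-odd : ∀ u j → addPart 1 (dilate 2 u) (suc (2 * j)) ≡ u j
addPart-1-dilate-2-odd u j = cong₂ _+_ (dilate-2-odd u j) (dilate-* 2 u j)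

addPart-1-dilate-2-≡1 : (∀ i → i ≤ k → u i ≡ 1) → s ≤ suc (2 * k) → addPart 1 (dilate 2 u) s ≡ 1
addPart-1-dilate-2-≡1 {k} {u} {s} u≡1 s≤1+2k with euclid 2 s
... | j , r , r<2 , refl = trans (at-remainder r r<2) (u≡1 j j≤k)
  where
  j≤k : j ≤ k
  j≤k = begin
    j                     ≡⟨ [d*k+r]/d≡k 2 j r<2 ⟨
    (2 * j + r) / 2       ≤⟨ /-monoˡ-≤ 2 s≤1+2k ⟩
    suc (2 * k) / 2       ≡⟨ cong (_/ 2) (+-comm 1 (2 * k)) ⟩
    (2 * k + 1) / 2       ≡⟨ [d*k+r]/d≡k 2 k (s≤s (s≤s z≤n)) ⟩
    k                     ∎
    where open ≤-Reasoning
  at-remainder : ∀ r → r < 2 → addPart 1 (dilate 2 u) (2 * j + r) ≡ u j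
  at-remainder zero          _ = trans (cong (addPart 1 (dilate 2 u)) (+-identityʳ (2 * j))) (addPart-1-dilate-2-even u j)
  at-remainder (suc zero)    _ = trans (cong (addPart 1 (dilate 2 u)) (+-comm (2 * j) 1)) (addPart-1-dilate-2-odd u j)
  at-remainder (suc (suc _)) (s≤s (s≤s ()))

-- The hypothesis says that the positive elements of P are 1 and the doubles of elements of P, i.e.
-- the powers of two; the lemma is the uniqueness of binary expansions.
distinctParts-binary : ∀ P → (∀ x → P (suc x) ≡ (suc x ≡ᵇ 1) ∨ dilated 2 P (suc x)) →
  ∀ m → s ≤ m → distinctParts P m s ≡ 1
distinctParts-binary P P≡1∨2P m = <-rec (λ m → ∀ {s} → s ≤ m → distinctParts P m s ≡ 1) unique m
  where
  disjoint : ∀ x → (suc x ≡ᵇ 1) ∧ dilated 2 P (suc x) ≡ false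
  disjoint zero    = refl
  disjoint (suc x) = refl
  parts-1 : ∀ m → distinctParts (_≡ᵇ 1) (suc m) ≗ addPart 1 δ₀
  parts-1 zero    s = refl
  parts-1 (suc m) s = parts-1 m s
  halve : ∀ m → distinctParts P (suc m) ≗ addPart 1 (dilate 2 (distinctParts P (suc m / 2)))
  halve m s = begin
    distinctParts P (suc m) s                                          ≡⟨ distinctParts-split P (_≡ᵇ 1) (dilated 2 P) P≡1∨2P disjoint (suc m) s ⟩
    conv (distinctParts (_≡ᵇ 1) (suc m)) (distinctParts (dilated 2 P) (suc m)) s
      ≡⟨ conv-cong (parts-1 m) (distinctParts-dilated 2 P (suc m)) s ⟩
    conv (addPart 1 δ₀) (dilate 2 (distinctParts P (suc m / 2))) s     ≡⟨ conv-addPartˡ 1 δ₀ _ s ⟩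
    addPart 1 (conv δ₀ (dilate 2 (distinctParts P (suc m / 2)))) s     ≡⟨ addPart-cong 1 (conv-δ₀ˡ _) s ⟩
    addPart 1 (dilate 2 (distinctParts P (suc m / 2))) s               ∎
    where open ≡-Reasoning
  unique : ∀ m → (∀ {m′} → m′ < m → ∀ {s} → s ≤ m′ → distinctParts P m′ s ≡ 1) → ∀ {s} → s ≤ m → distinctParts P m s ≡ 1
  unique zero    _   z≤n    = refl
  unique (suc m) rec s≤1+m = trans (halve m _)
    (addPart-1-dilate-2-≡1 (λ i i≤M → rec (m/n<m (suc m) 2 (s≤s (s≤s z≤n))) i≤M) (≤-trans s≤1+m (n≤1+2[n/2] (suc m))))

count : {A : Set} → (A → Bool) → List A → ℕ
count p xs = length (filter (T? ∘ p) xs)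

module _ {A : Set} (p : A → Bool) where

  count-++ : ∀ xs ys → count p (xs ++ ys) ≡ count p xs + count p ys
  count-++ xs ys = trans (cong length (filter-++ (T? ∘ p) xs ys)) (length-++ (filter (T? ∘ p) xs))

  count-false : (∀ x → p x ≡ false) → ∀ xs → count p xs ≡ 0
  count-false p≡false []       = refl
  count-false p≡false (x ∷ xs) rewrite p≡false x = count-false p≡false xs

count-∷ : ∀ {A : Set} (p : A → Bool) x xs → count p (x ∷ xs) ≡ toℕ (p x) + count p xs
count-∷ p x xs with p x
... | true  = refl
... | false = refl

count-map : ∀ {A B : Set} (p : B → Bool) (g : A → B) xs → count p (map g xs) ≡ count (p ∘ g) xs
count-map p g []       = refl
count-map p g (x ∷ xs) with p (g x)
... | true  = cong suc (count-map p g xs)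
... | false = count-map p g xs

subsetSums : List ℕ → ℕ → ℕ
subsetSums []       = δ₀
subsetSums (x ∷ xs) = addPart x (subsetSums xs)

count-+sum : ∀ x (ts : List (List ℕ)) → (λ s → count (λ t → x + sum t ≡ᵇ s) ts) ≗ shift x (λ s → count (λ t → sum t ≡ᵇ s) ts)
count-+sum zero    ts s       = refl
count-+sum (suc x) ts zero    = count-false _ (λ _ → refl) ts
count-+sum (suc x) ts (suc s) = count-+sum x ts s

count-subsets : ∀ xs s → count (λ t → sum t ≡ᵇ s) (subsets xs) ≡ subsetSums xs s
count-subsets []       zero    = refl
count-subsets []       (suc s) = refl
count-subsets (x ∷ xs) s = begin
  count p (subsets xs ++ map (x ∷_) (subsets xs))                         ≡⟨ count-++ p (subsets xs) _ ⟩
  count p (subsets xs) + count p (map (x ∷_) (subsets xs))                ≡⟨ cong₂ _+_ (count-subsets xs s) (count-map p (x ∷_) (subsets xs)) ⟩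
  subsetSums xs s + count (λ t → x + sum t ≡ᵇ s) (subsets xs)             ≡⟨ cong (subsetSums xs s +_) (count-+sum x (subsets xs) s) ⟩
  subsetSums xs s + shift x (λ s → count (λ t → sum t ≡ᵇ s) (subsets xs)) s ≡⟨ cong (subsetSums xs s +_) (shift-cong x (count-subsets xs) s) ⟩
  addPart x (subsetSums xs) s                                             ∎
  where
  open ≡-Reasoning
  p = λ t → sum t ≡ᵇ s

subsetSums-∷ʳ : ∀ xs x → subsetSums (xs ∷ʳ x) ≗ addPart x (subsetSums xs)
subsetSums-∷ʳ []       x s = refl
subsetSums-∷ʳ (y ∷ xs) x s = trans (addPart-cong y (subsetSums-∷ʳ xs x) s) (addPart-comm y x (subsetSums xs) s)

range1-suc : ∀ m → range1 (suc m) ≡ range1 m ∷ʳ suc m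
range1-suc m = trans (cong (map suc) (sym (upTo-∷ʳ m))) (map-++ suc (upTo m) [ m ])

subsetSums-range1 : ∀ P m → subsetSums (filter (T? ∘ P) (range1 m)) ≗ distinctParts P m
subsetSums-range1 P zero    s = refl
subsetSums-range1 P (suc m) s = begin
  subsetSums (filter (T? ∘ P) (range1 (suc m))) s
    ≡⟨ cong (λ xs → subsetSums (filter (T? ∘ P) xs) s) (range1-suc m) ⟩
  subsetSums (filter (T? ∘ P) (range1 m ∷ʳ suc m)) s
    ≡⟨ cong (λ xs → subsetSums xs s) (filter-++ (T? ∘ P) (range1 m) [ suc m ]) ⟩
  subsetSums (filter (T? ∘ P) (range1 m) ++ filter (T? ∘ P) [ suc m ]) s
    ≡⟨ last (P (suc m)) refl ⟩
  distinctParts P (suc m) s ∎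
  where
  open ≡-Reasoning
  F = filter (T? ∘ P) (range1 m)
  last : ∀ b → P (suc m) ≡ b → subsetSums (F ++ filter (T? ∘ P) [ suc m ]) s ≡ distinctParts P (suc m) s
  last true e rewrite e = begin
    subsetSums (F ∷ʳ suc m) s                       ≡⟨ subsetSums-∷ʳ F (suc m) s ⟩
    addPart (suc m) (subsetSums F) s                ≡⟨ addPart-cong (suc m) (subsetSums-range1 P m) s ⟩
    addPart (suc m) (distinctParts P m) s           ∎
  last false e rewrite e = trans (cong (λ xs → subsetSums xs s) (++-identityʳ F)) (subsetSums-range1 P m s)

f≡distinctParts : ∀ q n → f q n ≡ distinctParts (isTerm q) n n
f≡distinctParts q n = trans (count-subsets (terms q n) n) (subsetSums-range1 (isTerm q) n n)

countFrom : (ℕ → Bool) → ℕ → ℕ → ℕ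
countFrom p a zero    = 0
countFrom p a (suc l) = toℕ (p a) + countFrom p (suc a) l

module _ (p : ℕ → Bool) where

  count-applyUpTo : ∀ g a l → (∀ i → g i ≡ a + i) → count p (applyUpTo g l) ≡ countFrom p a l
  count-applyUpTo g a zero    _   = refl
  count-applyUpTo g a (suc l) g≡a+ = begin
    count p (g 0 ∷ applyUpTo (g ∘ suc) l)        ≡⟨ count-∷ p (g 0) _ ⟩
    toℕ (p (g 0)) + count p (applyUpTo (g ∘ suc) l)
      ≡⟨ cong₂ _+_ (cong (toℕ ∘ p) (trans (g≡a+ 0) (+-identityʳ a)))
                   (count-applyUpTo (g ∘ suc) (suc a) l (λ i → trans (g≡a+ (suc i)) (+-suc a i))) ⟩
    toℕ (p a) + countFrom p (suc a) l             ∎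
    where open ≡-Reasoning

  count-range1 : ∀ x → count p (range1 x) ≡ countFrom p 1 x
  count-range1 x = trans (cong (count p) (map-upTo suc x)) (count-applyUpTo suc 1 x (λ _ → refl))

  countFrom-cong : ∀ {p′} → (∀ i → p i ≡ p′ i) → ∀ a l → countFrom p a l ≡ countFrom p′ a l
  countFrom-cong p≡p′ a zero    = refl
  countFrom-cong p≡p′ a (suc l) = cong₂ _+_ (cong toℕ (p≡p′ a)) (countFrom-cong p≡p′ (suc a) l)

  countFrom-+ : ∀ a l₁ l₂ → countFrom p a (l₁ + l₂) ≡ countFrom p a l₁ + countFrom p (a + l₁) l₂
  countFrom-+ a zero     l₂ = cong (λ b → countFrom p b l₂) (sym (+-identityʳ a))
  countFrom-+ a (suc l₁) l₂ = begin
    toℕ (p a) + countFrom p (suc a) (l₁ + l₂)                               ≡⟨ cong (toℕ (p a) +_) (countFrom-+ (suc a) l₁ l₂) ⟩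
    toℕ (p a) + (countFrom p (suc a) l₁ + countFrom p (suc a + l₁) l₂)      ≡⟨ +-assoc (toℕ (p a)) _ _ ⟨
    countFrom p a (suc l₁) + countFrom p (suc a + l₁) l₂                    ≡⟨ cong (λ b → countFrom p a (suc l₁) + countFrom p b l₂) (+-suc a l₁) ⟨
    countFrom p a (suc l₁) + countFrom p (a + suc l₁) l₂                    ∎
    where open ≡-Reasoning

  countFrom-mono : ∀ a → l ≤ l′ → countFrom p a l ≤ countFrom p a l′
  countFrom-mono {l} a l≤l′ with o , refl ← m≤n⇒∃[o]m+o≡n l≤l′ =
    ≤-trans (m≤m+n _ _) (≤-reflexive (sym (countFrom-+ a l o)))

  countFrom-⊆ : ∀ {a₀ l₀} → a₀ ≤ a → a + l ≤ a₀ + l₀ → countFrom p a l ≤ countFrom p a₀ l₀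
  countFrom-⊆ {a} {l} {a₀} {l₀} a₀≤a a+l≤a₀+l₀ with o , refl ← m≤n⇒∃[o]m+o≡n a₀≤a = begin
    countFrom p (a₀ + o) l                         ≤⟨ m≤n+m _ _ ⟩
    countFrom p a₀ o + countFrom p (a₀ + o) l      ≡⟨ countFrom-+ a₀ o l ⟨
    countFrom p a₀ (o + l)                         ≤⟨ countFrom-mono a₀ (+-cancelˡ-≤ a₀ _ _ (≤-trans (≤-reflexive (sym (+-assoc a₀ o l))) a+l≤a₀+l₀)) ⟩
    countFrom p a₀ l₀                              ∎
    where open ≤-Reasoning

  countFrom-not : ∀ a l → countFrom p a l + countFrom (not ∘ p) a l ≡ l
  countFrom-not a zero    = refl
  countFrom-not a (suc l) with p a
  ... | true  = cong suc (countFrom-not (suc a) l)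
  ... | false = trans (+-suc _ _) (cong suc (countFrom-not (suc a) l))

  countFrom-witness : ∀ a l → 0 < countFrom p a l → ∃[ i ] (a ≤ i × p i ≡ true)
  countFrom-witness a (suc l) 0<count with p a in e
  ... | true  = a , ≤-refl , e
  ... | false with i , 1+a≤i , pi ← countFrom-witness (suc a) l 0<count = i , <⇒≤ 1+a≤i , pi

  countFrom-const : ∀ {b} a l → (∀ i → i < l → p (a + i) ≡ b) → countFrom p a l ≡ l * toℕ b
  countFrom-const a zero    _ = refl
  countFrom-const a (suc l) p≡b = cong₂ _+_
    (cong toℕ (trans (cong p (sym (+-identityʳ a))) (p≡b 0 z<s)))
    (countFrom-const (suc a) l (λ i i<l → trans (cong p (sym (+-suc a i))) (p≡b (suc i) (s<s i<l))))

  countFrom-alternating : ∀ a l → (∀ i → suc i < l → p (a + suc i) ≡ not (p (a + i))) → ⌊ l /2⌋ ≤ countFrom p a l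
  countFrom-alternating a zero          _   = z≤n
  countFrom-alternating a (suc zero)    _   = z≤n
  countFrom-alternating a (suc (suc l)) alt = begin
    suc ⌊ l /2⌋                                            ≤⟨ s≤s (countFrom-alternating (2 + a) l alt′) ⟩
    1 + countFrom p (2 + a) l                              ≡⟨ cong (_+ countFrom p (2 + a) l) one-of-two ⟨
    (toℕ (p a) + toℕ (p (1 + a))) + countFrom p (2 + a) l  ≡⟨ +-assoc (toℕ (p a)) _ _ ⟩
    countFrom p a (2 + l)                                  ∎
    where
    open ≤-Reasoning
    a+[2+i]≡2+a+i : ∀ i → a + (2 + i) ≡ 2 + a + i
    a+[2+i]≡2+a+i i = trans (+-suc a (suc i)) (cong suc (+-suc a i))
    alt′ : ∀ i → suc i < l → p (2 + a + suc i) ≡ not (p (2 + a + i))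
    alt′ i 1+i<l = subst₂ (λ x y → p x ≡ not (p y)) (a+[2+i]≡2+a+i (suc i)) (a+[2+i]≡2+a+i i) (alt (2 + i) (s<s (s<s 1+i<l)))
    p[1+a]≡not[p[a]] : p (1 + a) ≡ not (p a)
    p[1+a]≡not[p[a]] = subst₂ (λ x y → p x ≡ not (p y)) (+-comm a 1) (+-identityʳ a) (alt 0 (s≤s (s≤s z≤n)))
    one-of-two : toℕ (p a) + toℕ (p (1 + a)) ≡ 1
    one-of-two rewrite p[1+a]≡not[p[a]] with p a
    ... | true  = refl
    ... | false = refl

module _ (d : ℕ) .{{_ : NonZero d}} (p : ℕ → Bool) where

  countFrom-*suc : ∀ a l → countFrom p (d * a) (d * suc l) ≡ countFrom p (d * a) d + countFrom p (d * suc a) (d * l)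
  countFrom-*suc a l = begin
    countFrom p (d * a) (d * suc l)                            ≡⟨ cong (countFrom p (d * a)) (*-suc d l) ⟩
    countFrom p (d * a) (d + d * l)                            ≡⟨ countFrom-+ p (d * a) d (d * l) ⟩
    countFrom p (d * a) d + countFrom p (d * a + d) (d * l)    ≡⟨ cong (λ b → countFrom p (d * a) d + countFrom p b (d * l)) d*a+d≡d*[1+a] ⟩
    countFrom p (d * a) d + countFrom p (d * suc a) (d * l)    ∎
    where
    open ≡-Reasoning
    d*a+d≡d*[1+a] : d * a + d ≡ d * suc a
    d*a+d≡d*[1+a] = trans (+-comm (d * a) d) (sym (*-suc d a))

  countFrom-blockwise-const : ∀ p′ → (∀ m r → r < d → p (d * m + r) ≡ p′ m) →
    ∀ a l → countFrom p (d * a) (d * l) ≡ d * countFrom p′ a l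
  countFrom-blockwise-const p′ p≡p′ a zero    = trans (cong (countFrom p (d * a)) (*-zeroʳ d)) (sym (*-zeroʳ d))
  countFrom-blockwise-const p′ p≡p′ a (suc l) = begin
    countFrom p (d * a) (d * suc l)                            ≡⟨ countFrom-*suc a l ⟩
    countFrom p (d * a) d + countFrom p (d * suc a) (d * l)    ≡⟨ cong₂ _+_ block (countFrom-blockwise-const p′ p≡p′ (suc a) l) ⟩
    d * toℕ (p′ a) + d * countFrom p′ (suc a) l                ≡⟨ *-distribˡ-+ d (toℕ (p′ a)) _ ⟨
    d * countFrom p′ a (suc l)                                 ∎
    where
    open ≡-Reasoning
    block : countFrom p (d * a) d ≡ d * toℕ (p′ a)
    block = countFrom-const p (d * a) d (λ i i<d → p≡p′ a i i<d)

  countFrom-blockwise-≥ : ∀ p′ c → (∀ m → p′ m ≡ true → c ≤ countFrom p (d * m) d) →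
    ∀ a l → c * countFrom p′ a l ≤ countFrom p (d * a) (d * l)
  countFrom-blockwise-≥ p′ c block a zero    = ≤-trans (≤-reflexive (*-zeroʳ c)) z≤n
  countFrom-blockwise-≥ p′ c block a (suc l) = begin
    c * (toℕ (p′ a) + countFrom p′ (suc a) l)                  ≡⟨ *-distribˡ-+ c (toℕ (p′ a)) _ ⟩
    c * toℕ (p′ a) + c * countFrom p′ (suc a) l                ≤⟨ +-mono-≤ first (countFrom-blockwise-≥ p′ c block (suc a) l) ⟩
    countFrom p (d * a) d + countFrom p (d * suc a) (d * l)    ≡⟨ countFrom-*suc a l ⟨
    countFrom p (d * a) (d * suc l)                            ∎
    where
    open ≤-Reasoning
    first : c * toℕ (p′ a) ≤ countFrom p (d * a) d
    first with p′ a in e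
    ... | true  = ≤-trans (≤-reflexive (*-identityʳ c)) (block a e)
    ... | false = ≤-trans (≤-reflexive (*-zeroʳ c)) z≤n

odd : ℕ → Bool
odd n = n % 2 ≡ᵇ 1

odd-suc : ∀ n → odd (suc n) ≡ not (odd n)
odd-suc zero          = refl
odd-suc (suc zero)    = refl
odd-suc (suc (suc n)) = odd-suc n

odd-+ : odd n ≡ true → ∀ m → odd (m + n) ≡ not (odd m)
odd-+ odd-n zero    = odd-n
odd-+ odd-n (suc m) = trans (odd-suc (m + _)) (trans (cong not (odd-+ odd-n m)) (cong not (sym (odd-suc m))))

even≡not-odd : ∀ n → (n % 2 ≡ᵇ 0) ≡ not (odd n)
even≡not-odd zero          = refl
even≡not-odd (suc zero)    = refl
even≡not-odd (suc (suc n)) = even≡not-odd n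

IsTerm : ℕ → ℕ → Set
IsTerm q m = ∃[ a ] ∃[ b ] 2 ^ a * q ^ b ≡ m

isTerm-sound : ∀ q m → T (isTerm q m) → IsTerm q m
isTerm-sound q m t with a , _ , t′ ← applyUpTo⁻ id (any⁻ _ (upTo (suc m)) t)
                   with b , _ , t″ ← applyUpTo⁻ id (any⁻ _ (upTo (suc m)) t′) = a , b , ≡ᵇ⇒≡ _ _ t″

isTerm-complete : ∀ q m → 1 < q → IsTerm q m → T (isTerm q m)
isTerm-complete q@(suc _) m 1<q (a , b , 2^a*q^b≡m) =
  any⁺ _ (applyUpTo⁺ id (any⁺ _ (applyUpTo⁺ id (≡⇒≡ᵇ _ _ 2^a*q^b≡m) (s≤s b≤m))) (s≤s a≤m))
  where
  a≤m : a ≤ m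
  a≤m = <⇒≤ (≤-trans (n<b^n 2 (s≤s (s≤s z≤n)) a) (≤-trans (m≤m*n (2 ^ a) (q ^ b) {{m^n≢0 q b}}) (≤-reflexive 2^a*q^b≡m)))
  b≤m : b ≤ m
  b≤m = <⇒≤ (≤-trans (n<b^n q 1<q b) (≤-trans (m≤n*m (q ^ b) (2 ^ a) {{m^n≢0 2 a}}) (≤-reflexive 2^a*q^b≡m)))

EvenDensityBound : ℕ → Set
EvenDensityBound q = (a : ℕ) → 1 ≤ a → ∃[ X ] ((x : ℕ) → X ≤ x →
  (q ∸ 1) * a * x ≤ countEven q x * (2 * q * q * a) + 2 * q * q * x)

OddGrowthBound : ℕ → Set
OddGrowthBound q = ∃[ D ] (1 ≤ D × ∃[ X ] ((x : ℕ) → X ≤ x →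
  (j k : ℕ) → 1 ≤ k → q ^ j < ((q ∸ 1) / 2) ^ k → x ^ j ≤ (D * countOdd q x) ^ k))

module OddModulus (h : ℕ) (1≤h : 1 ≤ h) where

  q : ℕ
  q = 1 + 2 * h

  2<q : 2 < q
  2<q = s≤s (*-monoʳ-≤ 2 1≤h)

  1<q : 1 < q
  1<q = <-trans (s≤s (s≤s z≤n)) 2<q

  q∤2^a : ∀ a → ¬ q ∣ 2 ^ a
  q∤2^a zero    q∣1       = <⇒≢ 1<q (sym (∣1⇒≡1 q∣1))
  q∤2^a (suc a) q∣2*2^a   = q∤2^a a (coprime-divisor (coprime-odd-2 h) q∣2*2^a)

  isTerm-q* : ∀ y → isTerm q (q * y) ≡ isTerm q y
  isTerm-q* y = Bool-ext to from
    where
    to : T (isTerm q (q * y)) → T (isTerm q y)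
    to t with isTerm-sound q (q * y) t
    ... | a , zero , 2^a*1≡q*y =
      ⊥-elim (q∤2^a a (divides y (trans (sym (*-identityʳ (2 ^ a))) (trans 2^a*1≡q*y (*-comm q y)))))
    ... | a , suc b , 2^a*q^[1+b]≡q*y =
      isTerm-complete q y 1<q (a , b , *-cancelˡ-≡ _ _ q (trans (sym (x*[y*z]≡y*[x*z] (2 ^ a) q (q ^ b))) 2^a*q^[1+b]≡q*y))
    from : T (isTerm q y) → T (isTerm q (q * y))
    from t with a , b , 2^a*q^b≡y ← isTerm-sound q y t =
      isTerm-complete q (q * y) 1<q (a , suc b , trans (x*[y*z]≡y*[x*z] (2 ^ a) q (q ^ b)) (cong (q *_) 2^a*q^b≡y))

  -- Since q is odd, these are exactly the powers of two.
  isPow2 : ℕ → Bool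
  isPow2 x = isTerm q x ∧ not (x % q ≡ᵇ 0)

  isPow2-sound : ∀ x → T (isPow2 x) → ∃[ a ] 2 ^ a ≡ x
  isPow2-sound x t with Equivalence.to T-∧ t
  ... | isTerm-x , x%q≢0 with isTerm-sound q x isTerm-x
  ...   | a , zero , 2^a*1≡x = a , trans (sym (*-identityʳ (2 ^ a))) 2^a*1≡x
  ...   | a , suc b , 2^a*q^[1+b]≡x = ⊥-elim (subst (T ∘ not ∘ (_≡ᵇ 0)) x%q≡0 x%q≢0)
    where
    x%q≡0 : x % q ≡ 0
    x%q≡0 = n∣m⇒m%n≡0 x q (divides (2 ^ a * q ^ b) (begin
      x                         ≡⟨ 2^a*q^[1+b]≡x ⟨
      2 ^ a * (q * q ^ b)       ≡⟨ x*[y*z]≡y*[x*z] (2 ^ a) q (q ^ b) ⟩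
      q * (2 ^ a * q ^ b)       ≡⟨ *-comm q _ ⟩
      2 ^ a * q ^ b * q         ∎))
      where open ≡-Reasoning

  isPow2-complete : ∀ a → T (isPow2 (2 ^ a))
  isPow2-complete a with 2 ^ a % q in e
  ... | zero  = ⊥-elim (q∤2^a a (m%n≡0⇒n∣m _ q e))
  ... | suc _ = subst T (sym (∧-identityʳ _)) (isTerm-complete q (2 ^ a) 1<q (a , 0 , *-identityʳ _))

  isTerm-split : ∀ x → isTerm q (suc x) ≡ isPow2 (suc x) ∨ dilated q (isTerm q) (suc x)
  isTerm-split x with suc x % q ≡ᵇ 0 in e
  ... | true  = begin
    isTerm q (suc x)                                  ≡⟨ cong (isTerm q) (m*[n/m]≡n (m%n≡0⇒n∣m (suc x) q (≡ᵇ⇒≡ _ 0 (subst T (sym e) _)))) ⟨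
    isTerm q (q * (suc x / q))                        ≡⟨ isTerm-q* (suc x / q) ⟩
    isTerm q (suc x / q)                              ≡⟨ cong (_∨ isTerm q (suc x / q)) (∧-zeroʳ (isTerm q (suc x))) ⟨
    (isTerm q (suc x) ∧ false) ∨ isTerm q (suc x / q) ∎
    where open ≡-Reasoning
  ... | false = sym (trans (∨-identityʳ _) (∧-identityʳ _))

  isTerm-split-disjoint : ∀ x → isPow2 (suc x) ∧ dilated q (isTerm q) (suc x) ≡ false
  isTerm-split-disjoint x with suc x % q ≡ᵇ 0
  ... | true  = cong (_∧ isTerm q (suc x / q)) (∧-zeroʳ (isTerm q (suc x)))
  ... | false = ∧-zeroʳ (isTerm q (suc x) ∧ true)

  isPow2-split : ∀ x → isPow2 (suc x) ≡ (suc x ≡ᵇ 1) ∨ dilated 2 isPow2 (suc x)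
  isPow2-split x = Bool-ext to from
    where
    to : T (isPow2 (suc x)) → T ((suc x ≡ᵇ 1) ∨ dilated 2 isPow2 (suc x))
    to t with isPow2-sound (suc x) t
    ... | zero  , refl     = _
    ... | suc a , 2*2^a≡1+x = Equivalence.from T-∨ (inj₂ (subst T (sym 2P[1+x]≡P[2^a]) (isPow2-complete a)))
      where
      2P[1+x]≡P[2^a] : dilated 2 isPow2 (suc x) ≡ isPow2 (2 ^ a)
      2P[1+x]≡P[2^a] = trans (cong (dilated 2 isPow2) (sym 2*2^a≡1+x)) (dilated-* 2 isPow2 (2 ^ a))
    from : T ((suc x ≡ᵇ 1) ∨ dilated 2 isPow2 (suc x)) → T (isPow2 (suc x))
    from t with Equivalence.to T-∨ t
    ... | inj₁ 1+x≡ᵇ1 = subst (T ∘ isPow2) (sym (≡ᵇ⇒≡ (suc x) 1 1+x≡ᵇ1)) (isPow2-complete 0)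
    ... | inj₂ 2P[1+x] with 2∣1+x , P[[1+x]/2] ← Equivalence.to T-∧ 2P[1+x]
                       with a , 2^a≡[1+x]/2 ← isPow2-sound (suc x / 2) P[[1+x]/2] =
      subst (T ∘ isPow2) 2^[1+a]≡1+x (isPow2-complete (suc a))
      where
      2^[1+a]≡1+x : 2 ^ suc a ≡ suc x
      2^[1+a]≡1+x = trans (cong (2 *_) 2^a≡[1+x]/2) (m*[n/m]≡n (m%n≡0⇒n∣m (suc x) 2 (≡ᵇ⇒≡ _ 0 2∣1+x)))

  f-recurrence : ∀ n → f q n ≡ sumTo (f q) (suc (n / q))
  f-recurrence n = begin
    f q n                                                          ≡⟨ f≡distinctParts q n ⟩
    distinctParts S n n                                            ≡⟨ distinctParts-split S isPow2 qS isTerm-split isTerm-split-disjoint n n ⟩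
    conv (distinctParts isPow2 n) (distinctParts qS n) n           ≡⟨ conv-oneˡ (λ i → distinctParts-binary isPow2 isPow2-split n) ⟩
    sumTo (distinctParts qS n) (suc n)                             ≡⟨ sumTo-cong (suc n) (λ i _ → distinctParts-dilated q S n i) ⟩
    sumTo (dilate q (distinctParts S (n / q))) (suc n)             ≡⟨ sumTo-dilate q (distinctParts S (n / q)) n ⟩
    sumTo (distinctParts S (n / q)) (suc (n / q))                  ≡⟨ sumTo-cong (suc (n / q)) small-parts ⟩
    sumTo (f q) (suc (n / q))                                      ∎
    where
    open ≡-Reasoning
    S = isTerm q
    qS = dilated q S
    small-parts : ∀ i → i < suc (n / q) → distinctParts S (n / q) i ≡ f q i
    small-parts i i<1+n/q = trans (distinctParts-stable S (≤-pred i<1+n/q)) (sym (f≡distinctParts q i))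

  g : ℕ → ℕ
  g k = f q (q * k)

  f-*+ : ∀ k → r < q → f q (q * k + r) ≡ sumTo (f q) (suc k)
  f-*+ {r} k r<q = trans (f-recurrence (q * k + r)) (cong (sumTo (f q) ∘ suc) ([d*k+r]/d≡k q k r<q))

  g≡sumTo : ∀ k → g k ≡ sumTo (f q) (suc k)
  g≡sumTo k = trans (cong (f q) (sym (+-identityʳ (q * k)))) (f-*+ k z<s)

  f-block : ∀ k → r < q → f q (q * k + r) ≡ g k
  f-block k r<q = trans (f-*+ k r<q) (sym (g≡sumTo k))

  f-small : r < q → f q r ≡ 1
  f-small {r} r<q = trans (f-recurrence r) (cong (sumTo (f q) ∘ suc) (m<n⇒m/n≡0 r<q))

  g-suc : ∀ k → g (suc k) ≡ g k + f q (suc k)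
  g-suc k = trans (g≡sumTo (suc k)) (cong (_+ f q (suc k)) (sym (g≡sumTo k)))

  g-step : ∀ m → suc r < q → g (q * m + suc r) ≡ g (q * m + r) + g m
  g-step {r} m 1+r<q = begin
    g (q * m + suc r)                     ≡⟨ cong g (+-suc (q * m) r) ⟩
    g (suc (q * m + r))                   ≡⟨ g-suc (q * m + r) ⟩
    g (q * m + r) + f q (suc (q * m + r)) ≡⟨ cong (λ n → g (q * m + r) + f q n) (+-suc (q * m) r) ⟨
    g (q * m + r) + f q (q * m + suc r)   ≡⟨ cong (g (q * m + r) +_) (f-block m 1+r<q) ⟩
    g (q * m + r) + g m                   ∎
    where open ≡-Reasoning

  g-alternates : odd (g m) ≡ true → ∀ r → suc r < q → odd (g (q * m + suc r)) ≡ not (odd (g (q * m + r)))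
  g-alternates {m} odd-gm r 1+r<q = trans (cong odd (g-step m 1+r<q)) (odd-+ odd-gm (g (q * m + r)))

  odd-block : ∀ m → odd (g m) ≡ true → h ≤ countFrom (odd ∘ g) (q * m) q
  odd-block m odd-gm = subst (_≤ countFrom (odd ∘ g) (q * m) q) (⌊1+2h/2⌋≡h h)
    (countFrom-alternating (odd ∘ g) (q * m) q (g-alternates {m} odd-gm))

  even-block : ∀ m → odd (g m) ≡ true → h ≤ countFrom (not ∘ odd ∘ g) (q * m) q
  even-block m odd-gm = subst (_≤ countFrom (not ∘ odd ∘ g) (q * m) q) (⌊1+2h/2⌋≡h h)
    (countFrom-alternating (not ∘ odd ∘ g) (q * m) q (λ r 1+r<q → cong not (g-alternates {m} odd-gm r 1+r<q)))

  countFrom-f : ∀ (p : ℕ → Bool) a l → countFrom (p ∘ f q) (q * a) (q * l) ≡ q * countFrom (p ∘ g) a l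
  countFrom-f p = countFrom-blockwise-const q (p ∘ f q) (p ∘ g) (λ m r r<q → cong p (f-block m r<q))

  countEven-lower : ∀ x → h * (x / (q * q)) ≤ countEven q x
  countEven-lower x = begin
    h * M                                        ≡⟨ cong (h *_) (countFrom-not (odd ∘ g) 0 M) ⟨
    h * (countFrom (odd ∘ g) 0 M + countFrom even-g 0 M)
                                                 ≡⟨ *-distribˡ-+ h (countFrom (odd ∘ g) 0 M) _ ⟩
    h * countFrom (odd ∘ g) 0 M + h * countFrom even-g 0 M
                                                 ≤⟨ +-mono-≤ odd-m-blocks (*-monoʳ-≤ h (countFrom-mono even-g 0 (m≤n*m M q))) ⟩
    E + h * E                                    ≤⟨ *-monoˡ-≤ E (s≤s (m≤m+n h (h + 0))) ⟩
    q * E                                        ≡⟨ countFrom-f (not ∘ odd) 0 (q * M) ⟨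
    countFrom (not ∘ odd ∘ f q) (q * 0) (q * (q * M))
                                                 ≡⟨ cong (λ a → countFrom (not ∘ odd ∘ f q) a (q * (q * M))) (*-zeroʳ q) ⟩
    countFrom (not ∘ odd ∘ f q) 0 (q * (q * M))  ≤⟨ countFrom-mono (not ∘ odd ∘ f q) 0 q*[q*M]≤1+x ⟩
    countFrom (not ∘ odd ∘ f q) 0 (suc x)        ≡⟨ countFrom-cong _ (λ n → sym (even≡not-odd (f q n))) 1 x ⟩
    countFrom (λ n → f q n % 2 ≡ᵇ 0) 1 x         ≡⟨ count-range1 (λ n → f q n % 2 ≡ᵇ 0) x ⟨
    countEven q x                                ∎
    where
    open ≤-Reasoning
    M = x / (q * q)
    even-g = not ∘ odd ∘ g
    E = countFrom even-g 0 (q * M)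
    odd-m-blocks : h * countFrom (odd ∘ g) 0 M ≤ E
    odd-m-blocks = ≤-trans (countFrom-blockwise-≥ q even-g (odd ∘ g) h even-block 0 M)
                           (≤-reflexive (cong (λ a → countFrom even-g a (q * M)) (*-zeroʳ q)))
    q*[q*M]≤1+x : q * (q * M) ≤ suc x
    q*[q*M]≤1+x = ≤-trans (≤-reflexive (trans (sym (*-assoc q q M)) (*-comm (q * q) M))) (≤-trans (m/n*n≤m x (q * q)) (n≤1+n x))

  even-density : EvenDensityBound q
  even-density a _ = h * a , bound
    where
    bound : ∀ x → h * a ≤ x → 2 * h * a * x ≤ countEven q x * (2 * q * q * a) + 2 * q * q * x
    bound x ha≤x = begin
      2 * h * a * x                                   ≤⟨ *-monoʳ-≤ (2 * h * a) x≤Q*M+Q ⟩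
      2 * h * a * (Q * M + Q)                         ≡⟨ expand h a Q M ⟩
      2 * Q * a * (h * M) + 2 * Q * (h * a)           ≤⟨ +-mono-≤ (*-monoʳ-≤ (2 * Q * a) (countEven-lower x)) (*-monoʳ-≤ (2 * Q) ha≤x) ⟩
      2 * Q * a * countEven q x + 2 * Q * x           ≡⟨ regroup q a (countEven q x) x ⟩
      countEven q x * (2 * q * q * a) + 2 * q * q * x ∎
      where
      open ≤-Reasoning
      Q = q * q
      M = x / Q
      x≤Q*M+Q : x ≤ Q * M + Q
      x≤Q*M+Q = begin
        x             ≡⟨ m≡m%n+[m/n]*n x Q ⟩
        x % Q + M * Q ≤⟨ +-monoˡ-≤ (M * Q) (<⇒≤ (m%n<n x Q)) ⟩
        Q + M * Q     ≡⟨ trans (+-comm Q (M * Q)) (cong (_+ Q) (*-comm M Q)) ⟩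
        Q * M + Q     ∎
      expand : ∀ h a Q M → 2 * h * a * (Q * M + Q) ≡ 2 * Q * a * (h * M) + 2 * Q * (h * a)
      expand = solve-∀
      regroup : ∀ q a c x → 2 * (q * q) * a * c + 2 * (q * q) * x ≡ c * (2 * q * q * a) + 2 * q * q * x
      regroup = solve-∀

  g2-odd : odd (g 2) ≡ true
  g2-odd = cong odd (trans (g≡sumTo 2) (cong₂ (λ a b → 1 + a + b) (f-small 1<q) (f-small 2<q)))

  odd-levels : ∀ L → h ^ L ≤ countFrom (odd ∘ g) (2 * q ^ L) (q ^ L)
  odd-levels zero    = ≤-reflexive (cong (λ b → toℕ b + 0) (sym g2-odd))
  odd-levels (suc L) = begin
    h * h ^ L                                          ≤⟨ *-monoʳ-≤ h (odd-levels L) ⟩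
    h * countFrom (odd ∘ g) (2 * q ^ L) (q ^ L)        ≤⟨ countFrom-blockwise-≥ q (odd ∘ g) (odd ∘ g) h odd-block (2 * q ^ L) (q ^ L) ⟩
    countFrom (odd ∘ g) (q * (2 * q ^ L)) (q * q ^ L)  ≡⟨ cong (λ a → countFrom (odd ∘ g) a (q * q ^ L)) (x*[y*z]≡y*[x*z] q 2 (q ^ L)) ⟩
    countFrom (odd ∘ g) (2 * (q * q ^ L)) (q * q ^ L)  ∎
    where open ≤-Reasoning

  countOdd-lower : ∀ L x → 3 * q ^ suc L ≤ x → h ^ L ≤ countOdd q x
  countOdd-lower L x 3q^[1+L]≤x = begin
    h ^ L                                                ≤⟨ odd-levels L ⟩
    countFrom (odd ∘ g) (2 * q ^ L) (q ^ L)              ≤⟨ m≤n*m _ q ⟩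
    q * countFrom (odd ∘ g) (2 * q ^ L) (q ^ L)          ≡⟨ countFrom-f odd (2 * q ^ L) (q ^ L) ⟨
    countFrom (odd ∘ f q) (q * (2 * q ^ L)) (q * q ^ L)  ≤⟨ countFrom-⊆ (odd ∘ f q) 1≤start end≤1+x ⟩
    countFrom (odd ∘ f q) 1 x                            ≡⟨ count-range1 (odd ∘ f q) x ⟨
    countOdd q x                                         ∎
    where
    open ≤-Reasoning
    1≤start : 1 ≤ q * (2 * q ^ L)
    1≤start = ≤-trans (m^n>0 q L) (≤-trans (m≤n*m (q ^ L) 2) (m≤n*m (2 * q ^ L) q))
    q*2p+q*p≡3*[q*p] : ∀ q p → q * (2 * p) + q * p ≡ 3 * (q * p)
    q*2p+q*p≡3*[q*p] = solve-∀
    end≤1+x : q * (2 * q ^ L) + q * q ^ L ≤ 1 + x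
    end≤1+x = ≤-trans (≤-reflexive (q*2p+q*p≡3*[q*p] q (q ^ L))) (≤-trans 3q^[1+L]≤x (n≤1+n x))

  odd-growth : OddGrowthBound q
  odd-growth = 3 * q * q , s≤s z≤n , 3 * q , bound
    where
    h≤q : h ≤ q
    h≤q = ≤-trans (m≤m+n h (h + 0)) (n≤1+n _)
    q-powers-increasing : ∀ L → 3 * q ^ suc L < 3 * q ^ suc (suc L)
    q-powers-increasing L = *-monoʳ-< 3 (≤-trans (m<m*n (q ^ suc L) q {{m^n≢0 q (suc L)}} 1<q) (≤-reflexive (*-comm (q ^ suc L) q)))
    [q∸1]/2≡h : (q ∸ 1) / 2 ≡ h
    [q∸1]/2≡h = trans (cong (_/ 2) (*-comm 2 h)) (m*n/n≡m h 2)
    bound : ∀ x → 3 * q ≤ x → (j k : ℕ) → 1 ≤ k → q ^ j < ((q ∸ 1) / 2) ^ k → x ^ j ≤ (3 * q * q * countOdd q x) ^ k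
    bound x 3q≤x j k _ q^j<[[q∸1]/2]^k
      with L , 3q^[1+L]≤x , x<3q^[2+L] ← bracket (λ L → 3 * q ^ suc L) q-powers-increasing (≤-trans (≤-reflexive (cong (3 *_) (*-identityʳ q))) 3q≤x) =
      power-transfer q h (3 * q * q) (countOdd q x) L j k h≤q x≤3qq*q^L (countOdd-lower L x 3q^[1+L]≤x)
        (subst (λ z → q ^ j < z ^ k) [q∸1]/2≡h q^j<[[q∸1]/2]^k)
      where
      regroup : ∀ q p → 3 * (q * (q * p)) ≡ 3 * q * q * p
      regroup = solve-∀
      x≤3qq*q^L : x ≤ 3 * q * q * q ^ L
      x≤3qq*q^L = ≤-trans (<⇒≤ x<3q^[2+L]) (≤-reflexive (regroup q (q ^ L)))

  infinitely-many-odd : ∀ N → ∃[ n ] (N ≤ n × f q n % 2 ≡ 1)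
  infinitely-many-odd N
    with i , 2q^N≤i , odd-gi ← countFrom-witness (odd ∘ g) (2 * q ^ N) (q ^ N) (≤-trans (m^n>0 h {{>-nonZero 1≤h}} N) (odd-levels N)) =
    q * i , N≤q*i , ≡ᵇ⇒≡ _ 1 (subst T (sym odd-gi) _)
    where
    N≤q*i : N ≤ q * i
    N≤q*i = ≤-trans (<⇒≤ (n<b^n q 1<q N)) (≤-trans (m≤n*m (q ^ N) 2) (≤-trans 2q^N≤i (m≤n*m i q)))

odd-as-1+2h : ∀ q → 2 < q → q % 2 ≡ 1 → ∃[ h ] (1 ≤ h × q ≡ 1 + 2 * h)
odd-as-1+2h q 2<q q%2≡1 = q / 2 , m≥n⇒m/n>0 (<⇒≤ 2<q) , (begin
  q                 ≡⟨ m≡m%n+[m/n]*n q 2 ⟩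
  q % 2 + q / 2 * 2 ≡⟨ cong₂ _+_ q%2≡1 (*-comm (q / 2) 2) ⟩
  1 + 2 * (q / 2)   ∎)
  where open ≡-Reasoning

theorem3 : ((q : ℕ) → 2 < q → q % 2 ≡ 1 →
               -- liminf_{x→∞} countEven q x / x ≥ 1/(2q) − 1/(2q²) = (q−1)/(2q²):
               -- for every ε = 1/a there is X with countEven q x / x ≥ (q−1)/(2q²) − 1/a for x ≥ X
               ((a : ℕ) → 1 ≤ a → ∃[ X ] ((x : ℕ) → X ≤ x →
                  (q ∸ 1) * a * x ≤ countEven q x * (2 * q * q * a) + 2 * q * q * x))
               ×
               -- for q ≥ 5: ∃ C = 1/D > 0, ∃ X, ∀ x ≥ X, countOdd q x ≥ C · x^θ,
               -- θ = log((q−1)/2)/log q; encoded as: x^(j/k) ≤ D · countOdd q x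
               -- for every rational j/k < θ (i.e. q^j < ((q−1)/2)^k)
               (5 ≤ q → ∃[ D ] (1 ≤ D × ∃[ X ] ((x : ℕ) → X ≤ x →
                  (j k : ℕ) → 1 ≤ k → q ^ j < ((q ∸ 1) / 2) ^ k →
                  x ^ j ≤ (D * countOdd q x) ^ k))))
             ×
             -- f_{2,3}(n) is odd for infinitely many n
             ((N : ℕ) → ∃[ n ] (N ≤ n × f 3 n % 2 ≡ 1))
theorem3 = odd-moduli , OddModulus.infinitely-many-odd 1 ≤-refl
  where
  odd-moduli : (q : ℕ) → 2 < q → q % 2 ≡ 1 → EvenDensityBound q × (5 ≤ q → OddGrowthBound q)
  odd-moduli q 2<q q%2≡1 with h , 1≤h , refl ← odd-as-1+2h q 2<q q%2≡1 = even-density , λ _ → odd-growth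
    where open OddModulus h 1≤h
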